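{- Let $k=2$, $\Sigma_{actn}=\{a\}$, and let $P$ be the RB-template with states $p,q,r$, initial state $r$, atomic propositions $\{p,q,r\}$ with each state labeled exactly by its own name, and edges $(p,a_1,p)$, $(r,a_1,p)$, $(r,a_2,q)$, $(r,\mathfrak{b},r)$, $(p,\mathfrak{b},r)$, $(q,\mathfrak{b},r)$. Then the set $\mathrm{exec}_{inf}(P^\infty)$ is not $\omega$-regular.
   Context: For a process template $P=(AP,\Sigma_{rdz}\cup\{\mathfrak{b}\},S,I,R,\lambda)$ with $\Sigma_{rdz}=\{a_1,\dots,a_k : a\in\Sigma_{actn}\}$: the RB-system $P^n$ has configurations $f:[n]\to S$, initial configurations with all $f(i)\in I$, broadcast transitions where every process $i$ moves along some edge $(f(i),\mathfrak{b},g(i))\in R$, and rendezvous transitions where for some $a\in\Sigma_{actn}$ and pairwise distinct processes $i_1,\dots,i_k$, each $i_j$ moves along an edge $(f(i_j),a_j,g(i_j))\in R$ and all other processes stay. A run is a finite or infinite sequence of transitions starting in an initial configuration. For a run $\pi$ let $\mathrm{proj}_\pi(1)$ be the sequence of edges of $P$ taken by process 1 in the transitions in which it moves. $\mathrm{exec}_{inf}(P^\infty)$ is the set of infinite words $\lambda(\mathrm{src}(e_1))\lambda(\mathrm{src}(e_2))\cdots\in(2^{AP})^\omega$ where $e_1e_2\cdots=\mathrm{proj}_\pi(1)$ is infinite, over all runs $\pi$ of all $P^n$, $n\in\mathbb{N}$. -}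

module Defs where

open import Data.Nat using (ℕ; zero; suc; _≤_; _<_)
open import Data.Fin using (Fin; zero; suc)
open import Data.Fin.Subset using (Subset)
open import Data.Vec using (Vec; []; _∷_)
open import Data.Bool using (Bool; true; false)
open import Data.Unit using (⊤; tt)
open import Data.Product using (Σ; ∃; ∃-syntax; _×_; _,_)
open import Function.Definitions using (Injective)
open import Relation.Binary.PropositionalEquality using (_≡_; _≢_)
open import Relation.Nullary using (¬_)

data RLab (Actn : Set) (k : ℕ) : Set where
  rdz : Actn → Fin k → RLab Actn k     -- a_j  (j ranges over Fin k ≅ {1..k})
  𝔟   : RLab Actn k

record Template : Set₁ where
  field
    nAP   : ℕ                           -- AP ≅ Fin nAP
    State : Set
    Actn  : Set
    k     : ℕ
    Init  : State → Set
    Edge  : State → RLab Actn k → State → Set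
    lab   : State → Subset nAP

module RB (P : Template) where
  open Template P

  -- configurations of P^(suc n); process 1 is index zero
  Config : ℕ → Set
  Config n = Fin (suc n) → State

  InitConfig : ∀ {n} → Config n → Set
  InitConfig f = ∀ i → Init (f i)

  data Step {n : ℕ} (f g : Config n) : Set where
    bcast : (∀ i → Edge (f i) 𝔟 (g i)) → Step f g
    rendezvous : (a : Actn) (ι : Fin k → Fin (suc n)) → Injective _≡_ _≡_ ι →
                 (∀ j → Edge (f (ι j)) (rdz a j) (g (ι j))) →
                 (∀ i → (∀ j → ι j ≢ i) → g i ≡ f i) →
                 Step f g

  Moves1 : ∀ {n} {f g : Config n} → Step f g → Set
  Moves1 (bcast _) = ⊤
  Moves1 (rendezvous a ι _ _ _) = ∃[ j ] ι j ≡ zero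

  Word : Set
  Word = ℕ → Subset nAP

  -- w ∈ exec_inf(P^∞): there is some n and an infinite run of P^(suc n)
  -- in which process 1 moves infinitely often; τ enumerates (strictly
  -- increasingly) exactly the steps in which process 1 moves, and w m is the
  -- label of the source state of process 1's m-th edge.
  ExecInf : Word → Set
  ExecInf w =
    ∃[ n ] Σ (ℕ → Config n) λ c →
      InitConfig (c 0) ×
      Σ ((t : ℕ) → Step (c t) (c (suc t))) λ s →
      Σ (ℕ → ℕ) λ τ →
        (∀ m → τ m < τ (suc m)) ×
        (∀ m → Moves1 (s (τ m))) ×
        (∀ t → Moves1 (s t) → ∃[ m ] τ m ≡ t) ×
        (∀ m → w m ≡ lab (c (τ m) zero))

record Buchi (d : ℕ) : Set where
  field
    nQ    : ℕ
    init  : Fin nQ → Bool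
    δ     : Fin nQ → Subset d → Fin nQ → Bool
    acc   : Fin nQ → Bool

Accepts : ∀ {d} → Buchi d → (ℕ → Subset d) → Set
Accepts A w =
  Σ (ℕ → Fin nQ) λ ρ →
    init (ρ 0) ≡ true ×
    (∀ t → δ (ρ t) (w t) (ρ (suc t)) ≡ true) ×
    (∀ t → ∃[ t' ] t ≤ t' × acc (ρ t') ≡ true)
  where open Buchi A

OmegaRegular : ∀ {d} → ((ℕ → Subset d) → Set) → Set
OmegaRegular {d} L =
  ∃[ A ] ∀ (w : ℕ → Subset d) → (L w → Accepts A w) × (Accepts A w → L w)

data St : Set where
  p q r : St

-- k = 2, Σ_actn = {a} (≅ ⊤); a₁ = rdz tt zero, a₂ = rdz tt (suc zero)
a₁ a₂ : RLab ⊤ 2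
a₁ = rdz tt zero
a₂ = rdz tt (suc zero)

data Edge₀ : St → RLab ⊤ 2 → St → Set where
  p-a₁-p : Edge₀ p a₁ p
  r-a₁-p : Edge₀ r a₁ p
  r-a₂-q : Edge₀ r a₂ q
  r-𝔟-r  : Edge₀ r 𝔟 r
  p-𝔟-r  : Edge₀ p 𝔟 r
  q-𝔟-r  : Edge₀ q 𝔟 r

data IsInit : St → Set where
  r-init : IsInit r

-- AP = {p, q, r} ≅ Fin 3 with p ↦ 0, q ↦ 1, r ↦ 2; each state labelled by {itself}
labSt : St → Subset 3
labSt p = true  ∷ false ∷ false ∷ []
labSt q = false ∷ true  ∷ false ∷ []
labSt r = false ∷ false ∷ true  ∷ []

P₀ : Template
P₀ = record
  { nAP = 3 ; State = St ; Actn = ⊤ ; k = 2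
  ; Init = IsInit ; Edge = Edge₀ ; lab = labSt }

-- The word (r p^K)^ω is an execution for every K: K further processes take
-- their a₂-edge r → q one after another, each time in rendezvous with process 1,
-- and a broadcast then resets everybody to r.  Conversely, in an execution of
-- P^(n+1), whenever process 1 is in p at one of its moves, all steps since its
-- previous move were rendezvous (a broadcast would have left it in r), and each
-- rendezvous moves some process from r to q, where it stays until the next
-- broadcast; so executions have no block of more than n+2 consecutive p's.
-- A Büchi automaton with Q states accepting (r p^(Q+1))^ω has an accepting lasso
-- whose loop lies inside a block of p's; running the loop more and more often in
-- successive rounds of the lasso yields an accepted word with unboundedly long
-- p-blocks, which is no execution.
module Submission where

open import Algebra.Definitions.RawMonoid using (sum)
open import Data.Bool using (true; false; if_then_else_)
open import Data.Bool.Properties using (T-≡)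
open import Data.Empty using (⊥; ⊥-elim)
open import Data.Fin as Fin using (Fin; zero; suc; toℕ; fromℕ<)
open import Data.Fin.Properties using (pigeonhole; toℕ<n; toℕ-fromℕ<; toℕ-injective; any?)
open import Data.Fin.Subset using (Subset)
open import Data.Nat using (ℕ; zero; suc; _+_; _*_; _∸_; _/_; _%_; _≤_; _<_; _<ᵇ_; z≤n; s≤s; s≤s⁻¹; _≟_; _≤?_; _<?_; +-0-rawMonoid)
open import Data.Nat.DivMod using (m≡m%n+[m/n]*n; [m+kn]%n≡m%n; m<n⇒m%n≡m; m%n<n; n%n≡0)
open import Data.Nat.Properties
open import Data.Product using (Σ; ∃-syntax; _×_; _,_; proj₁; proj₂)
open import Data.Sum using (_⊎_; inj₁; inj₂)
open import Data.Unit using (tt)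
open import Function using (_∘_)
open import Function.Bundles using (Equivalence)
open import Function.Definitions using (Injective)
open import Relation.Nullary using (¬_; yes; no)
open import Relation.Binary.PropositionalEquality using (_≡_; _≢_; refl; sym; trans; cong; subst; module ≡-Reasoning)

open import Defs
open RB P₀

module _ {f : ℕ → ℕ} (f-inc : ∀ m → f m < f (suc m)) where

  inc⇒strictMono : ∀ {m n} → m < n → f m < f n
  inc⇒strictMono {m} {suc n} m<1+n with m<1+n⇒m<n∨m≡n m<1+n
  ... | inj₁ m<n  = <-trans (inc⇒strictMono m<n) (f-inc n)
  ... | inj₂ refl = f-inc m

  inc⇒mono : ∀ {m n} → m ≤ n → f m ≤ f n
  inc⇒mono m≤n with m≤n⇒m<n∨m≡n m≤n
  ... | inj₁ m<n  = <⇒≤ (inc⇒strictMono m<n)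
  ... | inj₂ refl = ≤-refl

  inc⇒no-value-between : ∀ m k → f m < f k → f k < f (suc m) → ⊥
  inc⇒no-value-between m k fm<fk fk<fm+1 with k ≤? m
  ... | yes k≤m = <⇒≱ fm<fk (inc⇒mono k≤m)
  ... | no  k≰m = <⇒≱ fk<fm+1 (inc⇒mono (≰⇒> k≰m))

pigeonholeℕ : ∀ {n} (f : ℕ → Fin n) → ∃[ i ] ∃[ j ] i < j × j ≤ n × f i ≡ f j
pigeonholeℕ {n} f with pigeonhole (n<1+n n) (f ∘ toℕ)
... | i , j , i<j , fi≡fj = toℕ i , toℕ j , i<j , s≤s⁻¹ (toℕ<n j) , fi≡fj

offsets : ∀ {b a e z} → b ≤ a → a < e → e < z →
          ∃[ α ] ∃[ δ ] ∃[ β ] a ≡ α + b × e ≡ suc δ + a × z ≡ suc β + e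
offsets b≤a a<e e<z =
  _ , _ , _ , sym (m∸n+n≡m b≤a) , suc+ a<e , suc+ e<z
  where
  suc+ : ∀ {m n} → m < n → n ≡ suc (n ∸ suc m + m)
  suc+ {m} m<n = trans (sym (m∸n+n≡m m<n)) (+-suc _ m)

Block : {A : Set} → (ℕ → A) → A → ℕ → ℕ → Set
Block w ℓ t L = ∀ i → i < L → w (i + t) ≡ ℓ

Block-∈ : ∀ {A : Set} {w : ℕ → A} {ℓ t L x} → Block w ℓ t L → t ≤ x → x < L + t → w x ≡ ℓ
Block-∈ {w = w} {ℓ} {t} {L} {x} block t≤x x<L+t =
  subst (λ y → w y ≡ ℓ) x∸t+t≡x
    (block (x ∸ t) (+-cancelʳ-< t _ _ (subst (_< L + t) (sym x∸t+t≡x) x<L+t)))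
  where
  x∸t+t≡x : x ∸ t + t ≡ x
  x∸t+t≡x = m∸n+n≡m t≤x

sum-mono-≤ : ∀ {k} {f g : Fin k → ℕ} → (∀ i → f i ≤ g i) → sum +-0-rawMonoid f ≤ sum +-0-rawMonoid g
sum-mono-≤ {zero}  f≤g = z≤n
sum-mono-≤ {suc k} f≤g = +-mono-≤ (f≤g zero) (sum-mono-≤ (f≤g ∘ suc))

sum-mono-< : ∀ {k} {f g : Fin k → ℕ} → (∀ i → f i ≤ g i) →
             ∀ i → f i < g i → sum +-0-rawMonoid f < sum +-0-rawMonoid g
sum-mono-< f≤g zero    fi<gi = +-mono-<-≤ fi<gi (sum-mono-≤ (f≤g ∘ suc))
sum-mono-< f≤g (suc i) fi<gi = +-mono-≤-< (f≤g zero) (sum-mono-< (f≤g ∘ suc) i fi<gi)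

sum≤card : ∀ {k} {f : Fin k → ℕ} → (∀ i → f i ≤ 1) → sum +-0-rawMonoid f ≤ k
sum≤card {zero}  f≤1 = z≤n
sum≤card {suc k} f≤1 = +-mono-≤ (f≤1 zero) (sum≤card (f≤1 ∘ suc))

-- (r p^K)^ω is an execution

<ᵇ-irrefl : ∀ n → (n <ᵇ n) ≡ false
<ᵇ-irrefl zero    = refl
<ᵇ-irrefl (suc n) = <ᵇ-irrefl n

<ᵇ-suc-≢ : ∀ m n → m ≢ n → (m <ᵇ suc n) ≡ (m <ᵇ n)
<ᵇ-suc-≢ zero    zero    m≢n = ⊥-elim (m≢n refl)
<ᵇ-suc-≢ zero    (suc n) m≢n = refl
<ᵇ-suc-≢ (suc m) zero    m≢n = refl
<ᵇ-suc-≢ (suc m) (suc n) m≢n = <ᵇ-suc-≢ m n (m≢n ∘ cong suc)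

<⇒<ᵇ≡true : ∀ {m n} → m < n → (m <ᵇ n) ≡ true
<⇒<ᵇ≡true = Equivalence.to T-≡ ∘ <⇒<ᵇ

leader : ℕ → St
leader zero    = r
leader (suc _) = p

leader-a₁ : ∀ x → Edge₀ (leader x) a₁ (leader (suc x))
leader-a₁ zero    = r-a₁-p
leader-a₁ (suc _) = p-a₁-p

leader-𝔟 : ∀ x → Edge₀ (leader x) 𝔟 r
leader-𝔟 zero    = r-𝔟-r
leader-𝔟 (suc _) = p-𝔟-r

-- After x rendezvous of the round, processes 2, …, x+1 have moved to q.
cycleConfig : (K x : ℕ) → Config K
cycleConfig K x zero    = leader x
cycleConfig K x (suc j) = if toℕ j <ᵇ x then q else r

cycleWord : ℕ → ℕ → Subset 3
cycleWord K t = labSt (leader (t % suc K))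

advance : ∀ {K x} → x < K → Step (cycleConfig K x) (cycleConfig K (suc x))
advance {K} {x} x<K = rendezvous tt ι ι-injective edges others
  where
  ι : Fin 2 → Fin (suc K)
  ι zero       = zero
  ι (suc zero) = suc (fromℕ< x<K)

  ι-injective : Injective _≡_ _≡_ ι
  ι-injective {zero}     {zero}     _ = refl
  ι-injective {suc zero} {suc zero} _ = refl
  ι-injective {zero}     {suc zero} ()
  ι-injective {suc zero} {zero}     ()

  edges : ∀ j → Edge₀ (cycleConfig K x (ι j)) (rdz tt j) (cycleConfig K (suc x) (ι j))
  edges zero = leader-a₁ x
  edges (suc zero) rewrite toℕ-fromℕ< x<K | <ᵇ-irrefl x | <⇒<ᵇ≡true (n<1+n x) = r-a₂-q

  others : ∀ i → (∀ j → ι j ≢ i) → cycleConfig K (suc x) i ≡ cycleConfig K x i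
  others zero    i∉ι = ⊥-elim (i∉ι zero refl)
  others (suc j) i∉ι = cong (λ b → if b then q else r) (<ᵇ-suc-≢ (toℕ j) x j≢x)
    where
    j≢x : toℕ j ≢ x
    j≢x j≡x = i∉ι (suc zero) (cong suc (toℕ-injective (trans (toℕ-fromℕ< x<K) (sym j≡x))))

reset : ∀ {K} → Step (cycleConfig K K) (cycleConfig K 0)
reset {K} = bcast edges
  where
  edges : ∀ i → Edge₀ (cycleConfig K K i) 𝔟 (cycleConfig K 0 i)
  edges zero = leader-𝔟 K
  edges (suc j) rewrite <⇒<ᵇ≡true (toℕ<n j) = q-𝔟-r

suc-% : ∀ t K → suc t % suc K ≡ suc (t % suc K) % suc K
suc-% t K = begin
  suc t % n                        ≡⟨ cong (λ m → suc m % n) (m≡m%n+[m/n]*n t n) ⟩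
  (suc (t % n) + (t / n) * n) % n  ≡⟨ [m+kn]%n≡m%n (suc (t % n)) (t / n) n ⟩
  suc (t % n) % n                  ∎
  where
  n = suc K
  open ≡-Reasoning

suc-%-cases : ∀ t K → (t % suc K < K × suc t % suc K ≡ suc (t % suc K))
                    ⊎ (t % suc K ≡ K × suc t % suc K ≡ 0)
suc-%-cases t K with m≤n⇒m<n∨m≡n (s≤s⁻¹ (m%n<n t (suc K)))
... | inj₁ x<K = inj₁ (x<K , trans (suc-% t K) (m<n⇒m%n≡m (s≤s x<K)))
... | inj₂ x≡K =
  inj₂ (x≡K , trans (suc-% t K) (trans (cong (λ x → suc x % suc K) x≡K) (n%n≡0 (suc K))))

cycleStep : ∀ K t → Σ (Step (cycleConfig K (t % suc K)) (cycleConfig K (suc t % suc K))) Moves1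
cycleStep K t with suc-%-cases t K
... | inj₁ (x<K , next) rewrite next         = advance x<K , zero , refl
... | inj₂ (x≡K , next) rewrite next | x≡K = reset , tt

cycleWord-execInf : ∀ K → ExecInf (cycleWord K)
cycleWord-execInf K =
  K , (λ t → cycleConfig K (t % suc K)) , (λ { zero → r-init ; (suc _) → r-init }) ,
  proj₁ ∘ cycleStep K , (λ m → m) , n<1+n , proj₂ ∘ cycleStep K , (λ t _ → t , refl) , (λ _ → refl)

cycleWord-blocks : ∀ K x → ∃[ y ] x ≤ y × Block (cycleWord K) (labSt p) y K
cycleWord-blocks K x = suc (x * suc K) , m≤n⇒m≤1+n (m≤m*n x (suc K)) , in-block
  where
  in-block : Block (cycleWord K) (labSt p) (suc (x * suc K)) K
  in-block i i<K = cong (labSt ∘ leader) (begin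
    (i + suc (x * suc K)) % suc K  ≡⟨ cong (_% suc K) (+-suc i (x * suc K)) ⟩
    (suc i + x * suc K) % suc K    ≡⟨ [m+kn]%n≡m%n (suc i) x (suc K) ⟩
    suc i % suc K                  ≡⟨ m<n⇒m%n≡m (s≤s i<K) ⟩
    suc i                          ∎)
    where open ≡-Reasoning

-- Executions have bounded p-blocks

isR : St → ℕ
isR p = 0
isR q = 0
isR r = 1

#r : ∀ {n} → Config n → ℕ
#r f = sum +-0-rawMonoid (isR ∘ f)

#r≤ : ∀ {n} (f : Config n) → #r f ≤ suc n
#r≤ f = sum≤card (isR≤1 ∘ f)
  where
  isR≤1 : ∀ x → isR x ≤ 1
  isR≤1 p = z≤n
  isR≤1 q = z≤n
  isR≤1 r = s≤s z≤n

rdz-isR-≤ : ∀ {x j y} → Edge₀ x (rdz tt j) y → isR y ≤ isR x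
rdz-isR-≤ p-a₁-p = z≤n
rdz-isR-≤ r-a₁-p = z≤n
rdz-isR-≤ r-a₂-q = z≤n

a₂-isR-< : ∀ {x y} → Edge₀ x a₂ y → isR y < isR x
a₂-isR-< r-a₂-q = s≤s z≤n

𝔟-target : ∀ {x y} → Edge₀ x 𝔟 y → y ≡ r
𝔟-target r-𝔟-r = refl
𝔟-target p-𝔟-r = refl
𝔟-target q-𝔟-r = refl

labSt≡p : ∀ {x} → labSt x ≡ labSt p → x ≡ p
labSt≡p {p} _ = refl

rendezvous-#r-< : ∀ {n} {f g : Config n} (ι : Fin 2 → Fin (suc n)) →
                  (∀ j → Edge₀ (f (ι j)) (rdz tt j) (g (ι j))) →
                  (∀ i → (∀ j → ι j ≢ i) → g i ≡ f i) → #r g < #r f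
rendezvous-#r-< {f = f} {g} ι edges others =
  sum-mono-< isR-≤ (ι (suc zero)) (a₂-isR-< (edges (suc zero)))
  where
  isR-≤ : ∀ i → isR (g i) ≤ isR (f i)
  isR-≤ i with any? (λ j → ι j Fin.≟ i)
  ... | yes (j , refl) = rdz-isR-≤ (edges j)
  ... | no  i∉ι       = ≤-reflexive (cong isR (others i (λ j ιj≡i → i∉ι (j , ιj≡i))))

step-#r-<-or-leader-r : ∀ {n} {f g : Config n} → Step f g → #r g < #r f ⊎ g zero ≡ r
step-#r-<-or-leader-r (bcast edges)                   = inj₂ (𝔟-target (edges zero))
step-#r-<-or-leader-r (rendezvous tt ι _ edges others) = inj₁ (rendezvous-#r-< ι edges others)

quiet-step : ∀ {n} {f g : Config n} (s : Step f g) → ¬ Moves1 s → g zero ≡ f zero × #r g ≤ #r f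
quiet-step (bcast _) quiet = ⊥-elim (quiet tt)
quiet-step (rendezvous tt ι _ edges others) quiet =
  others zero (λ j ιj≡0 → quiet (j , ιj≡0)) , <⇒≤ (rendezvous-#r-< ι edges others)

module Execution {n} {c : ℕ → Config n} (s : ∀ t → Step (c t) (c (suc t)))
                 {τ : ℕ → ℕ} (τ-inc : ∀ m → τ m < τ (suc m))
                 (τ-onto : ∀ t → Moves1 (s t) → ∃[ m ] τ m ≡ t) where

  quiet-stretch : ∀ k {t} → (∀ i → i < k → ¬ Moves1 (s (i + t))) →
                  c (k + t) zero ≡ c t zero × #r (c (k + t)) ≤ #r (c t)
  quiet-stretch zero    quiet = refl , ≤-refl
  quiet-stretch (suc k) quiet =
    let same , fewer   = quiet-step (s (k + _)) (quiet k (n<1+n k))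
        same′ , fewer′ = quiet-stretch k (λ i i<k → quiet i (m<n⇒m<1+n i<k))
    in trans same same′ , ≤-trans fewer fewer′

  quiet-between-moves : ∀ m → c (τ (suc m)) zero ≡ c (suc (τ m)) zero ×
                              #r (c (τ (suc m))) ≤ #r (c (suc (τ m)))
  quiet-between-moves m =
    subst (λ t → c t zero ≡ c (suc (τ m)) zero × #r (c t) ≤ #r (c (suc (τ m))))
          gap (quiet-stretch k quiet)
    where
    k : ℕ
    k = τ (suc m) ∸ suc (τ m)
    gap : k + suc (τ m) ≡ τ (suc m)
    gap = m∸n+n≡m (τ-inc m)
    quiet : ∀ i → i < k → ¬ Moves1 (s (i + suc (τ m)))
    quiet i i<k moves with τ-onto _ moves
    ... | m′ , τm′≡t = inc⇒no-value-between τ-inc m m′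
      (subst (τ m <_) (sym τm′≡t) (m≤n+m (suc (τ m)) i))
      (subst (_< τ (suc m)) (sym τm′≡t) (subst (i + suc (τ m) <_) gap (+-monoˡ-< (suc (τ m)) i<k)))

  move-to-p-#r-< : ∀ m → c (τ (suc m)) zero ≡ p → #r (c (τ (suc m))) < #r (c (τ m))
  move-to-p-#r-< m at-p with step-#r-<-or-leader-r (s (τ m)) | quiet-between-moves m
  ... | inj₁ fewer | _ , fewer′ = ≤-<-trans fewer′ fewer
  ... | inj₂ at-r  | same , _  with () ← trans (sym at-p) (trans same at-r)

  p-block-#r : ∀ k {m} → (∀ i → i < k → c (τ (suc i + m)) zero ≡ p) →
               #r (c (τ (k + m))) + k ≤ #r (c (τ m))
  p-block-#r zero    _    = ≤-reflexive (+-identityʳ _)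
  p-block-#r (suc k) {m} at-p = begin
    #r (c (τ (suc k + m))) + suc k  ≡⟨ +-suc _ k ⟩
    suc (#r (c (τ (suc k + m)))) + k ≤⟨ +-monoˡ-≤ k (move-to-p-#r-< (k + m) (at-p k (n<1+n k))) ⟩
    #r (c (τ (k + m))) + k          ≤⟨ p-block-#r k (λ i i<k → at-p i (m<n⇒m<1+n i<k)) ⟩
    #r (c (τ m))                    ∎
    where open ≤-Reasoning

execInf-p-blocks-bounded : ∀ {w} → ExecInf w → ∃[ L ] ∀ t → ¬ Block w (labSt p) t L
execInf-p-blocks-bounded {w} (n , c , _ , s , τ , τ-inc , _ , τ-onto , labels) = suc k , no-block
  where
  open Execution s τ-inc τ-onto
  k : ℕ
  k = suc (suc n)
  no-block : ∀ t → ¬ Block w (labSt p) t (suc k)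
  no-block t block = <⇒≱ (n<1+n (suc n))
    (≤-trans (m≤n+m k _) (≤-trans (p-block-#r k at-p) (#r≤ (c (τ t)))))
    where
    at-p : ∀ i → i < k → c (τ (suc i + t)) zero ≡ p
    at-p i i<k = labSt≡p (trans (sym (labels (suc i + t))) (block (suc i) (s≤s i<k)))

-- Pumping a lasso of an infinite run

-- The lasso b → a → e → z returns from e to a and from z to b; a cursor
-- ⟨ x , c , m ⟩ stands at position x of round m with c returns to a still due.
-- Round m makes m returns, so the loop [a, e) is traversed m + 1 times in a row.
module Pump (b α δ β : ℕ) where

  a e z : ℕ
  a = α + b
  e = suc δ + a
  z = suc β + e

  a<e : a < e
  a<e = s≤s (m≤n+m a δ)

  e<z : e < z
  e<z = s≤s (m≤n+m e β)

  b<z : b < z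
  b<z = ≤-<-trans (m≤n+m b α) (<-trans a<e e<z)

  record Cursor : Set where
    constructor ⟨_,_,_⟩
    field
      pos loops round : ℕ
  open Cursor

  forward : ℕ → ℕ → ℕ → Cursor
  forward x c m with suc x ≟ z
  ... | yes _ = ⟨ b , suc m , suc m ⟩
  ... | no  _ = ⟨ suc x , c , m ⟩

  step : Cursor → Cursor
  step ⟨ x , zero , m ⟩ = forward x zero m
  step ⟨ x , suc c , m ⟩ with suc x ≟ e
  ... | yes _ = ⟨ a , c , m ⟩
  ... | no  _ = forward x (suc c) m

  cursor : ℕ → Cursor
  cursor zero    = ⟨ 0 , 0 , 0 ⟩
  cursor (suc t) = step (cursor t)

  pump : ℕ → ℕ
  pump = pos ∘ cursor

  module _ {Q : Set} (f : ℕ → Q) (loop : f a ≡ f e) (lasso : f b ≡ f z) where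

    forward-compat : ∀ x c m → f (pos (forward x c m)) ≡ f (suc x)
    forward-compat x c m with suc x ≟ z
    ... | yes x+1≡z = trans lasso (cong f (sym x+1≡z))
    ... | no  _     = refl

    pump-compat : ∀ t → f (pump (suc t)) ≡ f (suc (pump t))
    pump-compat t with cursor t
    ... | ⟨ x , zero , m ⟩ = forward-compat x zero m
    ... | ⟨ x , suc c , m ⟩ with suc x ≟ e
    ...   | yes x+1≡e = trans loop (cong f (sym x+1≡e))
    ...   | no  _     = forward-compat x (suc c) m

  forward-below : ∀ {x c m} → suc x < z → forward x c m ≡ ⟨ suc x , c , m ⟩
  forward-below {x} x+1<z with suc x ≟ z
  ... | yes x+1≡z = ⊥-elim (<-irrefl x+1≡z x+1<z)
  ... | no  _     = refl

  step-below-z : ∀ {x m} → suc x < z → step ⟨ x , 0 , m ⟩ ≡ ⟨ suc x , 0 , m ⟩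
  step-below-z = forward-below

  step-below-e : ∀ {x c m} → suc x < e → step ⟨ x , c , m ⟩ ≡ ⟨ suc x , c , m ⟩
  step-below-e {c = zero}      x+1<e = forward-below (<-trans x+1<e e<z)
  step-below-e {x} {suc c} x+1<e with suc x ≟ e
  ... | yes x+1≡e = ⊥-elim (<-irrefl x+1≡e x+1<e)
  ... | no  _     = forward-below (<-trans x+1<e e<z)

  step-return : ∀ {c m} → step ⟨ δ + a , suc c , m ⟩ ≡ ⟨ a , c , m ⟩
  step-return with suc (δ + a) ≟ e
  ... | yes _   = refl
  ... | no  x≢e = ⊥-elim (x≢e refl)

  step-wrap : ∀ {m} → step ⟨ β + e , 0 , m ⟩ ≡ ⟨ b , suc m , suc m ⟩
  step-wrap with suc (β + e) ≟ z
  ... | yes _   = refl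
  ... | no  x≢z = ⊥-elim (x≢z refl)

  walk : ∀ {B c m} → (∀ {y} → suc y < B → step ⟨ y , c , m ⟩ ≡ ⟨ suc y , c , m ⟩) →
         ∀ k {t x} → k + x < B → cursor t ≡ ⟨ x , c , m ⟩ → cursor (k + t) ≡ ⟨ k + x , c , m ⟩
  walk advances zero    _       at = at
  walk advances (suc k) k+x<B at =
    trans (cong step (walk advances k (<-trans (n<1+n _) k+x<B) at)) (advances k+x<B)

  Reached : ℕ → Cursor → Set
  Reached T σ = ∃[ t ] T ≤ t × cursor t ≡ σ

  reached-walk : ∀ {B c m} → (∀ {y} → suc y < B → step ⟨ y , c , m ⟩ ≡ ⟨ suc y , c , m ⟩) →
                 ∀ k {T x} → k + x < B → Reached T ⟨ x , c , m ⟩ → Reached T ⟨ k + x , c , m ⟩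
  reached-walk advances k k+x<B (t , T≤t , at) =
    k + t , ≤-trans T≤t (m≤n+m t k) , walk advances k k+x<B at

  reached-step : ∀ {T σ σ′} → step σ ≡ σ′ → Reached T σ → Reached (suc T) σ′
  reached-step steps (t , T≤t , at) = suc t , s≤s T≤t , trans (cong step at) steps

  reached-weaken : ∀ {T σ} → Reached (suc T) σ → Reached T σ
  reached-weaken (t , T<t , at) = t , <⇒≤ T<t , at

  reached-returns : ∀ c {T m} → Reached T ⟨ a , c , m ⟩ → Reached T ⟨ a , 0 , m ⟩
  reached-returns zero    R = R
  reached-returns (suc c) R =
    reached-returns c (reached-weaken (reached-step step-return
      (reached-walk step-below-e δ (n<1+n (δ + a)) R)))

  reached-next-round : ∀ {T c m} → Reached T ⟨ b , c , m ⟩ → Reached (suc T) ⟨ b , suc m , suc m ⟩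
  reached-next-round {c = c} R =
    reached-weaken (reached-step step-wrap
      (reached-walk step-below-z β (n<1+n (β + e))
        (reached-step (step-below-z e<z)
          (reached-walk step-below-e δ (n<1+n (δ + a))
            (reached-returns c (reached-walk step-below-e α a<e R))))))

  reached-round : ∀ m → Reached m ⟨ b , m , m ⟩
  reached-round zero =
    subst (λ x → Reached 0 ⟨ x , 0 , 0 ⟩) (+-identityʳ b)
      (reached-walk step-below-z b (subst (_< z) (sym (+-identityʳ b)) b<z) (0 , z≤n , refl))
  reached-round (suc m) = reached-next-round (reached-round m)

  reached-pos : ∀ {B c m} → (∀ {y} → suc y < B → step ⟨ y , c , m ⟩ ≡ ⟨ suc y , c , m ⟩) →
                ∀ {T x g} → x ≤ g → g < B → Reached T ⟨ x , c , m ⟩ → ∃[ t ] T ≤ t × pump t ≡ g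
  reached-pos advances {x = x} {g} x≤g g<B R =
    let t , T≤t , at = reached-walk advances (g ∸ x) (subst (_< _) (sym g∸x+x≡g) g<B) R
    in t , T≤t , trans (cong pos at) g∸x+x≡g
    where
    g∸x+x≡g : g ∸ x + x ≡ g
    g∸x+x≡g = m∸n+n≡m x≤g

  pump-visits : ∀ {g} → b ≤ g → g < z → ∀ T → ∃[ t ] T ≤ t × pump t ≡ g
  pump-visits {g} b≤g g<z T with g <? e
  ... | yes g<e = reached-pos step-below-e b≤g g<e (reached-round T)
  ... | no  g≮e = reached-pos step-below-z (<⇒≤ (<-≤-trans a<e (≮⇒≥ g≮e))) g<z
                    (reached-returns T (reached-walk step-below-e α a<e (reached-round T)))

  InLoop : ℕ → Cursor → Set
  InLoop k σ = a ≤ pos σ × pos σ < e × k ≤ loops σ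

  step-in-loop : ∀ {k σ} → InLoop (suc k) σ → InLoop k (step σ)
  step-in-loop {σ = ⟨ x , suc c , m ⟩} (a≤x , x<e , s≤s k≤c) with suc x ≟ e
  ... | yes _     = ≤-refl , a<e , k≤c
  ... | no  x+1≢e = subst (InLoop _) (sym (forward-below (<-trans x+1<e e<z)))
                      (m≤n⇒m≤1+n a≤x , x+1<e , m≤n⇒m≤1+n k≤c)
    where
    x+1<e : suc x < e
    x+1<e = ≤∧≢⇒< x<e x+1≢e

  in-loop-for : ∀ i {k t} → InLoop (i + k) (cursor t) → InLoop k (cursor (i + t))
  in-loop-for zero    in-loop = in-loop
  in-loop-for (suc i) {k} {t} in-loop =
    step-in-loop (in-loop-for i (subst (λ j → InLoop j (cursor t)) (sym (+-suc i k)) in-loop))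

  pump-stays-in-loop : ∀ L → ∃[ t ] ∀ i → i < L → a ≤ pump (i + t) × pump (i + t) < e
  pump-stays-in-loop L =
    let t , _ , at = reached-walk step-below-e α a<e (reached-round L) in
    t , λ i i<L → let a≤ , <e , _ = in-loop-for i (subst (InLoop (i + 0)) (sym at)
                                      (≤-refl , a<e , ≤-trans (≤-reflexive (+-identityʳ i)) (<⇒≤ i<L)))
                  in a≤ , <e

-- Büchi automata

module _ {n} (A : Buchi n) where
  open Buchi A

  accepts-reindexed : ∀ {w : ℕ → Subset n} (ρ : ℕ → Fin nQ) (π : ℕ → ℕ) →
    init (ρ (π 0)) ≡ true → (∀ t → δ (ρ t) (w t) (ρ (suc t)) ≡ true) →
    (∀ t → ρ (π (suc t)) ≡ ρ (suc (π t))) →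
    (∀ t → ∃[ t′ ] t ≤ t′ × acc (ρ (π t′)) ≡ true) → Accepts A (w ∘ π)
  accepts-reindexed {w} ρ π init-π run compat infinitely-acc =
    ρ ∘ π , init-π ,
    (λ t → subst (λ q → δ (ρ (π t)) (w (π t)) q ≡ true) (sym (compat t)) (run (π t))) ,
    infinitely-acc

  module _ {w : ℕ → Subset n} (ρ : ℕ → Fin nQ)
           (ρ-init : init (ρ 0) ≡ true) (ρ-run : ∀ t → δ (ρ t) (w t) (ρ (suc t)) ≡ true) where

    lasso-pumping : ∀ {ℓ b a e z g} → b ≤ a → a < e → e < z → ρ a ≡ ρ e → ρ b ≡ ρ z →
      b ≤ g → g < z → acc (ρ g) ≡ true → (∀ x → a ≤ x → x < e → w x ≡ ℓ) →
      ∃[ w′ ] Accepts A w′ × (∀ L → ∃[ t ] Block w′ ℓ t L)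
    lasso-pumping b≤a a<e e<z loop lasso b≤g g<z g-acc loop-ℓ with offsets b≤a a<e e<z
    ... | α , δ′ , β , refl , refl , refl =
      w ∘ pump , accepts-reindexed ρ pump ρ-init ρ-run (pump-compat ρ loop lasso) accepting , blocks
      where
      open Pump _ α δ′ β
      accepting : ∀ t → ∃[ t′ ] t ≤ t′ × acc (ρ (pump t′)) ≡ true
      accepting t = let t′ , t≤t′ , at-g = pump-visits b≤g g<z t
                    in t′ , t≤t′ , subst (λ x → acc (ρ x) ≡ true) (sym at-g) g-acc
      blocks : ∀ L → ∃[ t ] Block (w ∘ pump) _ t L
      blocks L = let t , in-loop = pump-stays-in-loop L
                 in t , λ i i<L → loop-ℓ _ (proj₁ (in-loop i i<L)) (proj₂ (in-loop i i<L))

  module _ {w : ℕ → Subset n} (ρ : ℕ → Fin nQ) (ρ-acc : ∀ t → ∃[ t′ ] t ≤ t′ × acc (ρ t′) ≡ true) {ℓ}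
           (blocks : ∀ x → ∃[ y ] x ≤ y × Block w ℓ y (suc nQ)) where

    repeated-state-around-block :
      ∃[ X ] ∃[ Z ] ∃[ y ] ∃[ g ] ρ X ≡ ρ Z × X ≤ y × Block w ℓ y (suc nQ) ×
                                  nQ + y ≤ g × g < Z × acc (ρ g) ≡ true
    repeated-state-around-block =
      let I , J , I<J , _ , ρX≡ρZ = pigeonholeℕ (ρ ∘ h)
          y , X≤y , y-block = blocks (h I)
          _ , y+nQ≤g , g-acc = ρ-acc (nQ + y)
      in h I , h J , y , _ , ρX≡ρZ , X≤y , y-block , y+nQ≤g , inc⇒mono h-inc I<J , g-acc
      where
      next : ℕ → ℕ
      next x = let y , _ = blocks x ; g , _ = ρ-acc (nQ + y) in suc g

      h : ℕ → ℕ
      h zero    = 0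
      h (suc i) = next (h i)

      h-inc : ∀ i → h i < h (suc i)
      h-inc i = let y , x≤y , _ = blocks (h i) ; _ , y+nQ≤g , _ = ρ-acc (nQ + y)
                in s≤s (≤-trans x≤y (≤-trans (m≤n+m y nQ) y+nQ≤g))

  unbounded-blocks : ∀ {w} ℓ → Accepts A w → (∀ x → ∃[ y ] x ≤ y × Block w ℓ y (suc nQ)) →
                     ∃[ w′ ] Accepts A w′ × (∀ L → ∃[ t ] Block w′ ℓ t L)
  unbounded-blocks {w} ℓ (ρ , ρ-init , ρ-run , ρ-acc) blocks =
    let X , Z , y , g , ρX≡ρZ , X≤y , y-block , y+nQ≤g , g<Z , g-acc =
          repeated-state-around-block {w} ρ ρ-acc blocks
        U , V , U<V , V≤nQ , ρU≡ρV = pigeonholeℕ (λ u → ρ (u + y))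
        e<Z = ≤-<-trans (+-monoˡ-≤ y V≤nQ) (≤-<-trans y+nQ≤g g<Z)
        loop-ℓ = λ x a≤x x<e → Block-∈ {w = w} y-block (≤-trans (m≤n+m y U) a≤x)
                                 (<-≤-trans x<e (+-monoˡ-≤ y (m≤n⇒m≤1+n V≤nQ)))
    in lasso-pumping ρ ρ-init ρ-run (≤-trans X≤y (m≤n+m y U)) (+-monoˡ-< y U<V) e<Z ρU≡ρV ρX≡ρZ
         (≤-trans X≤y (≤-trans (m≤n+m y nQ) y+nQ≤g)) g<Z g-acc loop-ℓ

lemma3p8 : ¬ OmegaRegular (RB.ExecInf P₀)
lemma3p8 (A , exec⇔accepted) =
  let w , accepted , unbounded = unbounded-blocks A (labSt p)
                                   (proj₁ (exec⇔accepted _) (cycleWord-execInf K)) (cycleWord-blocks K)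
      L , bounded = execInf-p-blocks-bounded (proj₂ (exec⇔accepted w) accepted)
      t , block = unbounded L
  in bounded t block
  where
  K : ℕ
  K = suc (Buchi.nQ A)
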